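{- There is an algorithm that, given a universal $\mu$spec axiom $\textsc{ax}=\forall i_1\cdots\forall i_k\,\phi(i_1,\ldots,i_k)$ ($\phi$ quantifier-free, with given finite sets of cores, stages, operations and interpretations of predicates), determines whether $\textsc{ax}$ satisfies extensibility.
   Context: Programming model: cores $\mathsf{Cores}=[n]$; finite operation set $\mathbb{O}$; a program $\mathcal{P}$ is a family of instruction streams $\mathcal{I}_c\in\mathbb{O}^*$; an instruction is $(c,j,\mathcal{I}_c[j])$ with core $c$, label $j$, operation $\mathcal{I}_c[j]$; events are $i.\mathsf{st}$ for instructions $i$ of $\mathcal{P}$ and $\mathsf{st}$ in a finite set $\mathsf{Stages}$. $\mu$spec quantifier-free formulas are boolean combinations of atoms $i_1<_r i_2$, $\mathsf{hb}(i_1.\mathsf{st}_1,i_2.\mathsf{st}_2)$, $\mathsf{P}(i_1,\ldots)$ (with given interpretations $\mathsf{P}^{\mathcal{A}}\subseteq\mathbb{O}^k$). A $\mu$hb graph for $\mathcal{P}$ is a DAG $G=(V,E)$ on the events of $\mathcal{P}$. Under an assignment $s$: $i_1<_r i_2$ iff same core and smaller label; $\mathsf{P}(\ldots)$ iff the tuple of operations lies in $\mathsf{P}^{\mathcal{A}}$; $\mathsf{hb}(i_1.\mathsf{st}_1,i_2.\mathsf{st}_2)$ iff $(s(i_1).\mathsf{st}_1,s(i_2).\mathsf{st}_2)\in E^+$. Quantifiers range over instructions of $\mathcal{P}$ with distinct variables assigned distinct instructions; $G\models_{\mathcal{P}}\textsc{ax}$ denotes satisfaction. $\mathcal{P}'\preceq\mathcal{P}$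 (prefix) means each stream of $\mathcal{P}'$ is a prefix of the corresponding stream of $\mathcal{P}$; the residual $\mathcal{P}''=\mathcal{P}\oslash\mathcal{P}'$ has streams $\mathcal{I}''_c$ with $\mathcal{I}_c=\mathcal{I}'_c\cdot\mathcal{I}''_c$ (its instructions being those of $\mathcal{P}$ not in $\mathcal{P}'$). For graphs $G'=(V',E')$, $G''=(V'',E'')$ with disjoint vertex sets, $G'\triangleright G''=(V'\cup V'',\,E'\cup E''\cup\{(e',e''):e'\text{ a sink of }E',\ e''\text{ a source of }E''\})$. $\textsc{ax}$ satisfies extensibility if for all programs $\mathcal{P}'\preceq\mathcal{P}$ with $\mathcal{P}''=\mathcal{P}\oslash\mathcal{P}'$, whenever $G'\models_{\mathcal{P}'}\textsc{ax}$ and $G''\models_{\mathcal{P}''}\textsc{ax}$, then $G'\triangleright G''\models_{\mathcal{P}}\textsc{ax}$. -}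

module Defs where

open import Data.Nat using (ℕ; _<_; _+_)
open import Data.Fin using (Fin; toℕ; splitAt; cast)
open import Data.List using (List; length; _++_; lookup)
open import Data.List.Properties using (length-++)
open import Data.Vec using (Vec)
import Data.Vec as Vec
open import Data.Bool using (Bool; true; false)
open import Data.Product using (Σ; Σ-syntax; _×_; _,_; proj₁; proj₂)
open import Data.Sum using (_⊎_; inj₁; inj₂)
open import Data.Empty using (⊥)
open import Relation.Nullary using (¬_; Dec)
open import Relation.Binary.PropositionalEquality using (_≡_)
open import Relation.Binary.Construct.Closure.Transitive using (TransClosure)
open import Function.Definitions using (Injective)

record Signature : Set where
  field
    cores  : ℕ
    stages : ℕ
    ops    : ℕ
    npred  : ℕ
    arity  : Fin npred → ℕ
    interp : (p : Fin npred) → Vec (Fin ops) (arity p) → Bool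

module _ (S : Signature) where
  open Signature S

  data Formula (k : ℕ) : Set where
    po    : Fin k → Fin k → Formula k
    hb    : Fin k → Fin stages → Fin k → Fin stages → Formula k
    pred  : (p : Fin npred) → Vec (Fin k) (arity p) → Formula k
    ¬ᶠ_   : Formula k → Formula k
    _∧ᶠ_  : Formula k → Formula k → Formula k
    _∨ᶠ_  : Formula k → Formula k → Formula k

  record Axiom : Set where
    field
      k : ℕ
      φ : Formula k

  Program : Set
  Program = Fin cores → List (Fin ops)

  Instr : Program → Set
  Instr P = Σ[ c ∈ Fin cores ] Fin (length (P c))

  opOf : (P : Program) → Instr P → Fin ops
  opOf P (c , j) = lookup (P c) j

  Event : Program → Set
  Event P = Instr P × Fin stages

  Graph : Program → Set
  Graph P = Event P → Event P → Bool

  Edge : (P : Program) → Graph P → Event P → Event P → Set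
  Edge P G e₁ e₂ = G e₁ e₂ ≡ true

  Acyclic : (P : Program) → Graph P → Set
  Acyclic P G = (e : Event P) → ¬ TransClosure (Edge P G) e e

  ⟦_⟧ : {k : ℕ} → Formula k → (P : Program) → (Event P → Event P → Set)
        → (Fin k → Instr P) → Set
  ⟦ po a b ⟧ P E s = (proj₁ (s a) ≡ proj₁ (s b)) × (toℕ (proj₂ (s a)) < toℕ (proj₂ (s b)))
  ⟦ hb a st₁ b st₂ ⟧ P E s = TransClosure E (s a , st₁) (s b , st₂)
  ⟦ pred p xs ⟧ P E s = interp p (Vec.map (λ x → opOf P (s x)) xs) ≡ true
  ⟦ ¬ᶠ f ⟧ P E s = ¬ ⟦ f ⟧ P E s
  ⟦ f ∧ᶠ g ⟧ P E s = ⟦ f ⟧ P E s × ⟦ g ⟧ P E s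
  ⟦ f ∨ᶠ g ⟧ P E s = ⟦ f ⟧ P E s ⊎ ⟦ g ⟧ P E s

  SatRel : (P : Program) → (Event P → Event P → Set) → Axiom → Set
  SatRel P E ax = (s : Fin (Axiom.k ax) → Instr P) → Injective _≡_ _≡_ s
                  → ⟦ Axiom.φ ax ⟧ P E s

  Sat : (P : Program) → Graph P → Axiom → Set
  Sat P G ax = SatRel P (Edge P G) ax

  -- Concatenation P = P' · P'' (so P' ⪯ P and P'' = P ⊘ P').
  _⊕_ : Program → Program → Program
  (P' ⊕ P'') c = P' c ++ P'' c

  split : (P' P'' : Program) (c : Fin cores)
          → Fin (length ((P' ⊕ P'') c)) → Fin (length (P' c)) ⊎ Fin (length (P'' c))
  split P' P'' c j = splitAt (length (P' c)) (cast (length-++ (P' c)) j)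

  Sink : (P : Program) → Graph P → Event P → Set
  Sink P G e = (e₂ : Event P) → G e e₂ ≡ false

  Source : (P : Program) → Graph P → Event P → Set
  Source P G e = (e₁ : Event P) → G e₁ e ≡ false

  ▷Edge : (P' P'' : Program) → Graph P' → Graph P''
          → Event (P' ⊕ P'') → Event (P' ⊕ P'') → Set
  ▷Edge P' P'' G' G'' ((c₁ , j₁) , st₁) ((c₂ , j₂) , st₂)
    with split P' P'' c₁ j₁ | split P' P'' c₂ j₂
  ... | inj₁ a | inj₁ b = G' ((c₁ , a) , st₁) ((c₂ , b) , st₂) ≡ true
  ... | inj₂ a | inj₂ b = G'' ((c₁ , a) , st₁) ((c₂ , b) , st₂) ≡ true
  ... | inj₁ a | inj₂ b = Sink P' G' ((c₁ , a) , st₁) × Source P'' G'' ((c₂ , b) , st₂)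
  ... | inj₂ a | inj₁ b = ⊥

  Extensible : Axiom → Set
  Extensible ax =
    (P' P'' : Program) (G' : Graph P') (G'' : Graph P'')
    → Acyclic P' G' → Acyclic P'' G''
    → Sat P' G' ax → Sat P'' G'' ax
    → SatRel (P' ⊕ P'') (▷Edge P' P'' G' G'') ax

-- Whether an injective assignment of the k variables of ax into P′ ⊕ P″ satisfies φ under G′ ▷ G″
-- depends only on its shape: which part each variable lies in, its core, operation and rank on its
-- core, and the hb relation between the chosen events. An assignment inside one part is covered by
-- the hypothesis on that part, because ▷ neither creates nor destroys paths within a part. In a mixed
-- assignment, ▷ makes every prefix event reach every residual event and never the converse; these
-- constraints define the valid shapes. Conversely every valid shape is realised by a pair of
-- programs with fewer than k instructions each, which satisfy ax vacuously. Hence ax is extensible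
-- iff φ holds on all valid shapes of size k, and there are finitely many of them.

module Submission where

open import Defs
open import Data.Bool using (Bool; true; false; not)
import Data.Bool.Properties as Boolₚ
open import Data.Empty using (⊥-elim)
open import Data.Fin as Fin using (Fin; zero; suc; toℕ; inject₁; _↑ˡ_; _↑ʳ_; splitAt; cast; join)
import Data.Fin.Properties as Finₚ
open import Data.Fin.Subset using (Subset; ∣_∣; _∈_; _⊂_)
import Data.Fin.Subset.Properties as Subsetₚ
open import Data.List using (List; []; _∷_; length; _++_; lookup)
open import Data.List.Properties using (length-++)
open import Data.Nat using (ℕ; zero; suc; _+_; _<_; s≤s; z≤n)
import Data.Nat.Properties as ℕₚ
open import Data.Product using (Σ; ∃; _×_; _,_; proj₁; proj₂)
open import Data.Product.Function.NonDependent.Propositional using (_×-↔_; _×-⇔_)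
open import Data.Sum as Sum using (_⊎_; inj₁; inj₂)
import Data.Sum.Properties as Sumₚ
open import Data.Sum.Function.Propositional using (_⊎-↔_; _⊎-⇔_)
open import Data.Vec as Vec using (Vec; []; _∷_; tabulate)
import Data.Vec.Properties as Vecₚ
open import Function using (_∘_; flip; const)
open import Function.Bundles using (_↔_; mk↔ₛ′; Inverse; _⇔_; mk⇔; Equivalence)
open import Function.Construct.Composition using (_↔-∘_; _⇔-∘_)
open import Function.Construct.Identity using (↔-id; ⇔-id)
open import Function.Construct.Symmetry using (↔-sym; ⇔-sym)
open import Function.Definitions using (Injective)
open import Function.Related.TypeIsomorphisms using (¬-cong-⇔)
open import Induction.WellFounded using (WellFounded; Acc; acc)
open import Relation.Binary using (tri<; tri≈; tri>)
open import Relation.Binary.Construct.Closure.Transitive using (TransClosure; [_]; _∷_; _∷ʳ_) renaming (_++_ to _++⁺_)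
open import Relation.Binary.Definitions using (DecidableEquality)
open import Relation.Binary.PropositionalEquality using (_≡_; _≢_; refl; sym; trans; cong; cong₂; subst; subst₂)
open import Relation.Nullary using (¬_; Dec; yes; no; does)
open import Relation.Nullary.Decidable as Dec using (map′; _×-dec_; _⊎-dec_; _→-dec_; ¬?)
open import Relation.Unary using (Decidable)

Searchable : Set → Set₁
Searchable A = ∀ {P : A → Set} → Decidable P → Dec (∀ x → P x)

Bool-searchable : Searchable Bool
Bool-searchable P? with P? true | P? false
... | yes pt | yes pf = yes λ { true → pt ; false → pf }
... | no ¬pt | _      = no λ p → ¬pt (p true)
... | _      | no ¬pf = no λ p → ¬pf (p false)

×-searchable : ∀ {A B} → Searchable A → Searchable B → Searchable (A × B)
×-searchable all?ᴬ all?ᴮ P? =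
  map′ (λ p (a , b) → p a b) (λ p a b → p (a , b)) (all?ᴬ λ a → all?ᴮ λ b → P? (a , b))

Vec-searchable : ∀ {A} n → Searchable A → Searchable (Vec A n)
Vec-searchable zero    all? P? = map′ (λ { p [] → p }) (λ p → p []) (P? [])
Vec-searchable (suc n) all? P? =
  map′ (λ { p (a ∷ as) → p a as }) (λ p a as → p (a ∷ as))
       (all? λ a → Vec-searchable n all? λ as → P? (a ∷ as))

record Finite (A : Set) : Set where
  field
    size        : ℕ
    enumeration : A ↔ Fin size

  open Inverse enumeration public using () renaming (to to index; from to element)
  open Inverse enumeration using (strictlyInverseʳ)

  index-injective : ∀ {x y} → index x ≡ index y → x ≡ y
  index-injective {x} {y} eq =
    trans (sym (strictlyInverseʳ x)) (trans (cong element eq) (strictlyInverseʳ y))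

  _≟_ : DecidableEquality A
  x ≟ y = map′ index-injective (cong index) (index x Finₚ.≟ index y)

  all? : Searchable A
  all? {P} P? = map′ (λ p x → subst P (strictlyInverseʳ x) (p (index x))) (λ p i → p (element i))
                     (Finₚ.all? (P? ∘ element))

  any? : ∀ {P : A → Set} → Decidable P → Dec (∃ P)
  any? {P} P? = map′ (λ (i , p) → element i , p)
                     (λ (x , p) → index x , subst P (sym (strictlyInverseʳ x)) p)
                     (Finₚ.any? (P? ∘ element))


Fin-finite : ∀ n → Finite (Fin n)
Fin-finite n = record { enumeration = ↔-id (Fin n) }

×-finite : ∀ {A B} → Finite A → Finite B → Finite (A × B)
×-finite FA FB = record
  { enumeration = ↔-sym Finₚ.*↔× ↔-∘ (Finite.enumeration FA ×-↔ Finite.enumeration FB) }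

Σ-finite : ∀ {n} {B : Fin n → Set} → (∀ i → Finite (B i)) → Finite (Σ (Fin n) B)
Σ-finite {zero}      FB = record { size = 0 ; enumeration = mk↔ₛ′ (λ ()) (λ ()) (λ ()) (λ ()) }
Σ-finite {suc n} {B} FB = record
  { enumeration = ↔-sym Finₚ.+↔⊎ ↔-∘ ((Finite.enumeration (FB zero) ⊎-↔ Finite.enumeration (Σ-finite (FB ∘ suc))) ↔-∘ Σ-suc↔⊎) }
  where
  Σ-suc↔⊎ : Σ (Fin (suc n)) B ↔ (B zero ⊎ Σ (Fin n) (B ∘ suc))
  Σ-suc↔⊎ = mk↔ₛ′ (λ { (zero , b) → inj₁ b ; (suc i , b) → inj₂ (i , b) })
                  (λ { (inj₁ b) → zero , b ; (inj₂ (i , b)) → suc i , b })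
                  (λ { (inj₁ b) → refl ; (inj₂ (i , b)) → refl })
                  (λ { (zero , b) → refl ; (suc i , b) → refl })

module FiniteAcyclic {V : Set} (fin : Finite V) (_⟶_ : V → V → Set)
                     (_⟶?_ : ∀ x y → Dec (x ⟶ y)) (acyclic : ∀ x → ¬ TransClosure _⟶_ x x) where

  open Finite fin

  _⟶⁺_ : V → V → Set
  _⟶⁺_ = TransClosure _⟶_

  Walk : ℕ → V → Set
  Walk m x = Σ (Fin (suc m) → V) λ w → w zero ≡ x × (∀ i → w (inject₁ i) ⟶ w (suc i))

  walk⁺ : ∀ {m} (w : Fin (suc m) → V) → (∀ i → w (inject₁ i) ⟶ w (suc i)) →
          ∀ {i j} → i Fin.< j → w i ⟶⁺ w j
  walk⁺ {suc m} w steps {zero} {suc zero}    _         = [ steps zero ]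
  walk⁺ {suc m} w steps {zero} {suc (suc j)} _         = steps zero ∷ walk⁺ (w ∘ suc) (steps ∘ suc) {zero} {suc j} (s≤s z≤n)
  walk⁺ {suc m} w steps {suc i} {suc j}      (s≤s i<j) = walk⁺ (w ∘ suc) (steps ∘ suc) i<j

  -- A walk visiting more than size vertices repeats one, closing a cycle.
  no-long-walk : ∀ x → ¬ Walk size x
  no-long-walk x (w , _ , steps) with Finₚ.pigeonhole (ℕₚ.n<1+n size) (index ∘ w)
  ... | i , j , i<j , same = acyclic (w j) (subst (_⟶⁺ w j) (index-injective same) (walk⁺ w steps i<j))

  acc-without-walk : ∀ m x → ¬ Walk m x → Acc (flip _⟶_) x
  acc-without-walk zero    x ¬walk = ⊥-elim (¬walk ((λ _ → x) , refl , λ ()))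
  acc-without-walk (suc m) x ¬walk = acc λ {y} x⟶y → acc-without-walk m y (¬walk ∘ extend x⟶y)
    where
    extend : ∀ {y} → x ⟶ y → Walk m y → Walk (suc m) x
    extend {y} x⟶y (w , refl , steps) = w′ , refl , steps′
      where
      w′ : Fin (suc (suc m)) → V
      w′ zero    = x
      w′ (suc i) = w i
      steps′ : ∀ i → w′ (inject₁ i) ⟶ w′ (suc i)
      steps′ zero    = x⟶y
      steps′ (suc i) = steps i

  wellFounded : WellFounded (flip _⟶_)
  wellFounded x = acc-without-walk size x (no-long-walk x)

  _⟶⁺?_ : ∀ x y → Dec (x ⟶⁺ y)
  x ⟶⁺? y = go (wellFounded x)
    where
    go : ∀ {x} → Acc (flip _⟶_) x → Dec (x ⟶⁺ y)
    go {x} (acc rs) = map′ from-first-step first-step (any? step?)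
      where
      step? : ∀ z → Dec (x ⟶ z × (z ≡ y ⊎ z ⟶⁺ y))
      step? z with x ⟶? z
      ... | yes x⟶z = map′ (x⟶z ,_) proj₂ ((z ≟ y) ⊎-dec go (rs x⟶z))
      ... | no ¬x⟶z = no (¬x⟶z ∘ proj₁)
      from-first-step : ∃ (λ z → x ⟶ z × (z ≡ y ⊎ z ⟶⁺ y)) → x ⟶⁺ y
      from-first-step (_ , x⟶z , inj₁ refl) = [ x⟶z ]
      from-first-step (_ , x⟶z , inj₂ z⟶⁺y) = x⟶z ∷ z⟶⁺y
      first-step : x ⟶⁺ y → ∃ (λ z → x ⟶ z × (z ≡ y ⊎ z ⟶⁺ y))
      first-step [ x⟶y ]       = _ , x⟶y , inj₁ refl
      first-step (x⟶z ∷ z⟶⁺y) = _ , x⟶z , inj₂ z⟶⁺y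

  reaches-sink : ∀ x → ∃ λ t → (∀ z → ¬ t ⟶ z) × (t ≡ x ⊎ x ⟶⁺ t)
  reaches-sink x = go (wellFounded x)
    where
    go : ∀ {x} → Acc (flip _⟶_) x → ∃ λ t → (∀ z → ¬ t ⟶ z) × (t ≡ x ⊎ x ⟶⁺ t)
    go {x} (acc rs) with any? (x ⟶?_)
    ... | no ¬step = x , (λ z x⟶z → ¬step (z , x⟶z)) , inj₁ refl
    ... | yes (z , x⟶z) with go (rs x⟶z)
    ...   | t , sink , inj₁ refl  = t , sink , inj₂ [ x⟶z ]
    ...   | t , sink , inj₂ z⟶⁺t = t , sink , inj₂ (x⟶z ∷ z⟶⁺t)

injective⇒hits : ∀ {n} (h : Fin n → Fin n) → Injective _≡_ _≡_ h → ∀ w → ¬ (∀ i → h i ≢ w)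
injective⇒hits {suc m} h h-injective w misses =
  Finₚ.<⇒notInjective (ℕₚ.n<1+n m) λ eq → h-injective (Finₚ.punchOut-injective (avoids _) (avoids _) eq)
  where
  avoids : ∀ i → w ≢ h i
  avoids i = misses i ∘ sym

module _ {m n} {f : Fin m → Fin n} (f-mono : ∀ {i j} → i Fin.< j → f i Fin.< f j) where

  strictMono⇒reflects-< : ∀ {i j} → f i Fin.< f j → i Fin.< j
  strictMono⇒reflects-< {i} {j} fi<fj with Finₚ.<-cmp i j
  ... | tri< i<j _ _ = i<j
  ... | tri≈ _ refl _ = ⊥-elim (Finₚ.<-irrefl refl fi<fj)
  ... | tri> _ _ j<i = ⊥-elim (Finₚ.<-asym fi<fj (f-mono j<i))

  strictMono⇒injective : Injective _≡_ _≡_ f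
  strictMono⇒injective {i} {j} fi≡fj with Finₚ.<-cmp i j
  ... | tri< i<j _ _ = ⊥-elim (Finₚ.<-irrefl fi≡fj (f-mono i<j))
  ... | tri≈ _ i≡j _ = i≡j
  ... | tri> _ _ j<i = ⊥-elim (Finₚ.<-irrefl (sym fi≡fj) (f-mono j<i))

module _ {A : Set} where

  select : ∀ {n} → (Fin n → Bool) → (Fin n → A) → List A
  select {zero}  keep f = []
  select {suc n} keep f with keep zero
  ... | true  = f zero ∷ select (keep ∘ suc) (f ∘ suc)
  ... | false = select (keep ∘ suc) (f ∘ suc)

  origin : ∀ {n} (keep : Fin n → Bool) (f : Fin n → A) → Fin (length (select keep f)) → Fin n
  origin {suc n} keep f j with keep zero
  origin {suc n} keep f zero    | true  = zero
  origin {suc n} keep f (suc j) | true  = suc (origin (keep ∘ suc) (f ∘ suc) j)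
  origin {suc n} keep f j       | false = suc (origin (keep ∘ suc) (f ∘ suc) j)

  position : ∀ {n} (keep : Fin n → Bool) (f : Fin n → A) i → keep i ≡ true → Fin (length (select keep f))
  position {suc n} keep f zero kept with keep zero
  ... | true = zero
  position {suc n} keep f zero () | false
  position {suc n} keep f (suc i) kept with keep zero
  ... | true  = suc (position (keep ∘ suc) (f ∘ suc) i kept)
  ... | false = position (keep ∘ suc) (f ∘ suc) i kept

  lookup-select : ∀ {n} (keep : Fin n → Bool) (f : Fin n → A) j → lookup (select keep f) j ≡ f (origin keep f j)
  lookup-select {suc n} keep f j with keep zero
  lookup-select {suc n} keep f zero    | true  = refl
  lookup-select {suc n} keep f (suc j) | true  = lookup-select (keep ∘ suc) (f ∘ suc) j
  lookup-select {suc n} keep f j       | false = lookup-select (keep ∘ suc) (f ∘ suc) j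

  origin-kept : ∀ {n} (keep : Fin n → Bool) (f : Fin n → A) j → keep (origin keep f j) ≡ true
  origin-kept {suc n} keep f j with keep zero in kept
  origin-kept {suc n} keep f zero    | true  = kept
  origin-kept {suc n} keep f (suc j) | true  = origin-kept (keep ∘ suc) (f ∘ suc) j
  origin-kept {suc n} keep f j       | false = origin-kept (keep ∘ suc) (f ∘ suc) j

  origin-mono : ∀ {n} (keep : Fin n → Bool) (f : Fin n → A) {j j′} → j Fin.< j′ → origin keep f j Fin.< origin keep f j′
  origin-mono {suc n} keep f {j} {j′} j<j′ with keep zero
  origin-mono {suc n} keep f {zero}  {suc j′} j<j′      | true  = s≤s z≤n
  origin-mono {suc n} keep f {suc j} {suc j′} (s≤s j<j′) | true  = s≤s (origin-mono (keep ∘ suc) (f ∘ suc) j<j′)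
  origin-mono {suc n} keep f {j}     {j′}     j<j′      | false = s≤s (origin-mono (keep ∘ suc) (f ∘ suc) j<j′)

  origin-position : ∀ {n} (keep : Fin n → Bool) (f : Fin n → A) i kept → origin keep f (position keep f i kept) ≡ i
  origin-position {suc n} keep f zero kept with keep zero
  ... | true = refl
  origin-position {suc n} keep f zero () | false
  origin-position {suc n} keep f (suc i) kept with keep zero
  ... | true  = cong suc (origin-position (keep ∘ suc) (f ∘ suc) i kept)
  ... | false = cong suc (origin-position (keep ∘ suc) (f ∘ suc) i kept)

  position-<⇔ : ∀ {n} (keep : Fin n → Bool) (f : Fin n → A) {i i′} ki ki′ →
                position keep f i ki Fin.< position keep f i′ ki′ ⇔ i Fin.< i′
  position-<⇔ keep f {i} {i′} ki ki′ = mk⇔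
    (λ lt → subst₂ Fin._<_ (origin-position keep f i ki) (origin-position keep f i′ ki′) (origin-mono keep f lt))
    (λ lt → strictMono⇒reflects-< (origin-mono keep f)
              (subst₂ Fin._<_ (sym (origin-position keep f i ki)) (sym (origin-position keep f i′ ki′)) lt))

does≡true⇔ : ∀ {A : Set} (a? : Dec A) → does a? ≡ true ⇔ A
does≡true⇔ (yes a) = mk⇔ (λ _ → a) (λ _ → refl)
does≡true⇔ (no ¬a) = mk⇔ (λ ()) (⊥-elim ∘ ¬a)

module _ {n} {P : Fin n → Set} (P? : Decidable P) where

  subset : Subset n
  subset = Vec.tabulate (does ∘ P?)

  ∈-subset⁺ : ∀ {w} → P w → w ∈ subset
  ∈-subset⁺ {w} p =
    Vecₚ.lookup⇒[]= w subset (trans (Vecₚ.lookup∘tabulate (does ∘ P?) w) (Equivalence.from (does≡true⇔ (P? w)) p))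

  ∈-subset⁻ : ∀ {w} → w ∈ subset → P w
  ∈-subset⁻ {w} w∈ =
    Equivalence.to (does≡true⇔ (P? w)) (trans (sym (Vecₚ.lookup∘tabulate (does ∘ P?) w)) (Vecₚ.[]=⇒lookup w∈))

module Rank {k} {C : Set} (_≟_ : DecidableEquality C) (class : Fin k → C) (key : Fin k → ℕ)
            (separates : ∀ {u v} → class u ≡ class v → key u ≡ key v → u ≡ v) where

  Below : Fin k → Fin k → Set
  Below v w = class w ≡ class v × key w < key v

  below? : ∀ v → Decidable (Below v)
  below? v w = (class w ≟ class v) ×-dec (key w ℕₚ.<? key v)

  below : Fin k → Subset k
  below v = subset (below? v)

  below-⊂ : ∀ {u v} → class u ≡ class v → key u < key v → below u ⊂ below v
  below-⊂ {u} {v} same u<v =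
      (λ w∈ → let (same′ , w<u) = ∈-subset⁻ (below? u) w∈ in ∈-subset⁺ (below? v) (trans same′ same , ℕₚ.<-trans w<u u<v))
    , u , ∈-subset⁺ (below? v) (same , u<v) , λ u∈ → ℕₚ.<-irrefl refl (proj₂ (∈-subset⁻ (below? u) u∈))

  ∣below∣<k : ∀ v → ∣ below v ∣ < k
  ∣below∣<k v = subst (∣ below v ∣ <_) (Subsetₚ.∣⊤∣≡n k)
    (Subsetₚ.p⊂q⇒∣p∣<∣q∣ ((λ _ → Subsetₚ.∈⊤) , v , Subsetₚ.∈⊤ , λ v∈ → ℕₚ.<-irrefl refl (proj₂ (∈-subset⁻ (below? v) v∈))))

  rank : Fin k → Fin k
  rank v = Fin.fromℕ< (∣below∣<k v)

  rank-mono : ∀ {u v} → class u ≡ class v → key u < key v → rank u Fin.< rank v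
  rank-mono {u} {v} same u<v = subst₂ _<_ (sym (Finₚ.toℕ-fromℕ< (∣below∣<k u))) (sym (Finₚ.toℕ-fromℕ< (∣below∣<k v)))
    (Subsetₚ.p⊂q⇒∣p∣<∣q∣ (below-⊂ same u<v))

  rank-reflects-< : ∀ {u v} → class u ≡ class v → rank u Fin.< rank v → key u < key v
  rank-reflects-< {u} {v} same ru<rv with ℕₚ.<-cmp (key u) (key v)
  ... | tri< u<v _ _ = u<v
  ... | tri≈ _ u≡v _ with separates same u≡v
  ...   | refl = ⊥-elim (Finₚ.<-irrefl refl ru<rv)
  rank-reflects-< {u} {v} same ru<rv | tri> _ _ v<u = ⊥-elim (Finₚ.<-asym ru<rv (rank-mono (sym same) v<u))

  rank-injective : ∀ {u v} → class u ≡ class v → rank u ≡ rank v → u ≡ v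
  rank-injective {u} {v} same ru≡rv with ℕₚ.<-cmp (key u) (key v)
  ... | tri< u<v _ _ = ⊥-elim (Finₚ.<-irrefl ru≡rv (rank-mono same u<v))
  ... | tri≈ _ u≡v _ = separates same u≡v
  ... | tri> _ _ v<u = ⊥-elim (Finₚ.<-irrefl (sym ru≡rv) (rank-mono (sym same) v<u))

Σ-Fin-≡ : ∀ {n} {L : Fin n → ℕ} {x y : Σ (Fin n) (Fin ∘ L)} → proj₁ x ≡ proj₁ y → toℕ (proj₂ x) ≡ toℕ (proj₂ y) → x ≡ y
Σ-Fin-≡ {x = c , j} {.c , j′} refl eq = cong (c ,_) (Finₚ.toℕ-injective eq)

map⁺ : ∀ {A B : Set} {R : A → A → Set} {Q : B → B → Set} (f : A → B) →
       (∀ {x y} → R x y → Q (f x) (f y)) → ∀ {x y} → TransClosure R x y → TransClosure Q (f x) (f y)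
map⁺ f R⇒Q [ r ]     = [ R⇒Q r ]
map⁺ f R⇒Q (r ∷ rs) = R⇒Q r ∷ map⁺ f R⇒Q rs

reverse⁺ : ∀ {A : Set} {R : A → A → Set} {x y} → TransClosure (flip R) x y → TransClosure R y x
reverse⁺ [ r ]     = [ r ]
reverse⁺ (r ∷ rs) = reverse⁺ rs ∷ʳ r

lookup-++-↑ˡ : ∀ {A : Set} (xs ys : List A) (j : Fin (length xs)) →
               lookup (xs ++ ys) (cast (sym (length-++ xs)) (j ↑ˡ length ys)) ≡ lookup xs j
lookup-++-↑ˡ (x ∷ xs) ys zero    = refl
lookup-++-↑ˡ (x ∷ xs) ys (suc j) = lookup-++-↑ˡ xs ys j

lookup-++-↑ʳ : ∀ {A : Set} (xs ys : List A) (j : Fin (length ys)) →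
               lookup (xs ++ ys) (cast (sym (length-++ xs)) (length xs ↑ʳ j)) ≡ lookup ys j
lookup-++-↑ʳ []       ys j = cong (lookup ys) (Finₚ.cast-is-id refl j)
lookup-++-↑ʳ (x ∷ xs) ys j = lookup-++-↑ʳ xs ys j

module _ (S : Signature) where
  open Signature S

  record Atoms (k : ℕ) : Set₁ where
    field
      poᵃ   : Fin k → Fin k → Set
      hbᵃ   : Fin k → Fin stages → Fin k → Fin stages → Set
      predᵃ : (p : Fin npred) → Vec (Fin k) (arity p) → Set

  Holds : ∀ {k} → Atoms k → Formula S k → Set
  Holds A (po a b)     = Atoms.poᵃ A a b
  Holds A (hb a s b t) = Atoms.hbᵃ A a s b t
  Holds A (pred p xs)  = Atoms.predᵃ A p xs
  Holds A (¬ᶠ φ)       = ¬ Holds A φ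
  Holds A (φ ∧ᶠ ψ)     = Holds A φ × Holds A ψ
  Holds A (φ ∨ᶠ ψ)     = Holds A φ ⊎ Holds A ψ

  record DecidableAtoms {k} (A : Atoms k) : Set where
    open Atoms A
    field
      poᵃ?   : ∀ a b → Dec (poᵃ a b)
      hbᵃ?   : ∀ a s b t → Dec (hbᵃ a s b t)
      predᵃ? : ∀ p xs → Dec (predᵃ p xs)

  Holds? : ∀ {k} {A : Atoms k} → DecidableAtoms A → Decidable (Holds A)
  Holds? A? (po a b)     = DecidableAtoms.poᵃ? A? a b
  Holds? A? (hb a s b t) = DecidableAtoms.hbᵃ? A? a s b t
  Holds? A? (pred p xs)  = DecidableAtoms.predᵃ? A? p xs
  Holds? A? (¬ᶠ φ)       = ¬? (Holds? A? φ)
  Holds? A? (φ ∧ᶠ ψ)     = Holds? A? φ ×-dec Holds? A? ψ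
  Holds? A? (φ ∨ᶠ ψ)     = Holds? A? φ ⊎-dec Holds? A? ψ

  record _≈ᵃ_ {k} (A B : Atoms k) : Set where
    field
      poᵃ-⇔   : ∀ a b → Atoms.poᵃ A a b ⇔ Atoms.poᵃ B a b
      hbᵃ-⇔   : ∀ a s b t → Atoms.hbᵃ A a s b t ⇔ Atoms.hbᵃ B a s b t
      predᵃ-⇔ : ∀ p xs → Atoms.predᵃ A p xs ⇔ Atoms.predᵃ B p xs

  Holds-cong : ∀ {k} {A B : Atoms k} → A ≈ᵃ B → ∀ φ → Holds A φ ⇔ Holds B φ
  Holds-cong A≈B (po a b)     = _≈ᵃ_.poᵃ-⇔ A≈B a b
  Holds-cong A≈B (hb a s b t) = _≈ᵃ_.hbᵃ-⇔ A≈B a s b t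
  Holds-cong A≈B (pred p xs)  = _≈ᵃ_.predᵃ-⇔ A≈B p xs
  Holds-cong A≈B (¬ᶠ φ)       = ¬-cong-⇔ (Holds-cong A≈B φ)
  Holds-cong A≈B (φ ∧ᶠ ψ)     = Holds-cong A≈B φ ×-⇔ Holds-cong A≈B ψ
  Holds-cong A≈B (φ ∨ᶠ ψ)     = Holds-cong A≈B φ ⊎-⇔ Holds-cong A≈B ψ

  ProgramOrder : (P : Program S) → Instr S P → Instr S P → Set
  ProgramOrder P x y = proj₁ x ≡ proj₁ y × toℕ (proj₂ x) < toℕ (proj₂ y)

  atomsOf : ∀ {k} (P : Program S) → (Event S P → Event S P → Set) → (Fin k → Instr S P) → Atoms k
  atomsOf P E s = record
    { poᵃ   = λ a b → ProgramOrder P (s a) (s b)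
    ; hbᵃ   = λ a st b st′ → TransClosure E (s a , st) (s b , st′)
    ; predᵃ = λ p xs → interp p (Vec.map (opOf S P ∘ s) xs) ≡ true
    }

  ⟦⟧⇔Holds : ∀ {k} (P : Program S) E (s : Fin k → Instr S P) φ → ⟦_⟧ S φ P E s ⇔ Holds (atomsOf P E s) φ
  ⟦⟧⇔Holds P E s (po a b)     = ⇔-id _
  ⟦⟧⇔Holds P E s (hb a x b y) = ⇔-id _
  ⟦⟧⇔Holds P E s (pred p xs)  = ⇔-id _
  ⟦⟧⇔Holds P E s (¬ᶠ φ)       = ¬-cong-⇔ (⟦⟧⇔Holds P E s φ)
  ⟦⟧⇔Holds P E s (φ ∧ᶠ ψ)     = ⟦⟧⇔Holds P E s φ ×-⇔ ⟦⟧⇔Holds P E s ψ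
  ⟦⟧⇔Holds P E s (φ ∨ᶠ ψ)     = ⟦⟧⇔Holds P E s φ ⊎-⇔ ⟦⟧⇔Holds P E s ψ

  interp-cong : ∀ {k} (f g : Fin k → Fin ops) → (∀ v → f v ≡ g v) →
                ∀ p xs → (interp p (Vec.map f xs) ≡ true) ⇔ (interp p (Vec.map g xs) ≡ true)
  interp-cong f g f≗g p xs rewrite Vecₚ.map-cong f≗g xs = ⇔-id _

  module Concat (P′ P″ : Program S) where

    P : Program S
    P = _⊕_ S P′ P″

    embed : ∀ c → Fin (length (P′ c)) ⊎ Fin (length (P″ c)) → Fin (length (P c))
    embed c = cast (sym (length-++ (P′ c))) ∘ join _ _

    split-embed : ∀ c z → split S P′ P″ c (embed c z) ≡ z
    split-embed c z = trans (cong (splitAt (length (P′ c))) (Finₚ.cast-involutive (length-++ (P′ c)) (sym (length-++ (P′ c))) (join _ _ z)))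
                            (Finₚ.splitAt-join (length (P′ c)) (length (P″ c)) z)

    embed-split : ∀ c j → embed c (split S P′ P″ c j) ≡ j
    embed-split c j = trans (cong (cast (sym (length-++ (P′ c)))) (Finₚ.join-splitAt (length (P′ c)) (length (P″ c)) _))
                            (Finₚ.cast-involutive (sym (length-++ (P′ c))) (length-++ (P′ c)) j)

    inl : Instr S P′ → Instr S P
    inl (c , j) = c , embed c (inj₁ j)

    inr : Instr S P″ → Instr S P
    inr (c , j) = c , embed c (inj₂ j)

    locate : Instr S P → Instr S P′ ⊎ Instr S P″
    locate (c , j) = Sum.map (c ,_) (c ,_) (split S P′ P″ c j)

    locate-inl : ∀ a → locate (inl a) ≡ inj₁ a
    locate-inl (c , j) = cong (Sum.map (c ,_) (c ,_)) (split-embed c (inj₁ j))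

    locate-inr : ∀ b → locate (inr b) ≡ inj₂ b
    locate-inr (c , j) = cong (Sum.map (c ,_) (c ,_)) (split-embed c (inj₂ j))

    inl-injective : ∀ {a a′} → inl a ≡ inl a′ → a ≡ a′
    inl-injective {a} {a′} eq = Sumₚ.inj₁-injective (trans (sym (locate-inl a)) (trans (cong locate eq) (locate-inl a′)))

    inr-injective : ∀ {b b′} → inr b ≡ inr b′ → b ≡ b′
    inr-injective {b} {b′} eq = Sumₚ.inj₂-injective (trans (sym (locate-inr b)) (trans (cong locate eq) (locate-inr b′)))

    inl≢inr : ∀ {a b} → inl a ≢ inr b
    inl≢inr {a} {b} eq with trans (sym (locate-inl a)) (trans (cong locate eq) (locate-inr b))
    ... | ()

    data Located : Instr S P → Set where
      prefix   : ∀ a → Located (inl a)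
      residual : ∀ b → Located (inr b)

    located : ∀ x → Located x
    located (c , j) = subst (λ j → Located (c , j)) (embed-split c j) (by-part (split S P′ P″ c j))
      where
      by-part : ∀ z → Located (c , embed c z)
      by-part (inj₁ a) = prefix (c , a)
      by-part (inj₂ b) = residual (c , b)

    isResidual : Instr S P → Bool
    isResidual = Sum.[ const false , const true ] ∘ locate

    isResidual-inl : ∀ a → isResidual (inl a) ≡ false
    isResidual-inl a = cong Sum.[ const false , const true ] (locate-inl a)

    isResidual-inr : ∀ b → isResidual (inr b) ≡ true
    isResidual-inr b = cong Sum.[ const false , const true ] (locate-inr b)

    position-inl : ∀ c j → toℕ (proj₂ (inl (c , j))) ≡ toℕ j
    position-inl c j = trans (Finₚ.toℕ-cast _ _) (Finₚ.toℕ-↑ˡ j _)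

    position-inr : ∀ c j → toℕ (proj₂ (inr (c , j))) ≡ length (P′ c) + toℕ j
    position-inr c j = trans (Finₚ.toℕ-cast _ _) (Finₚ.toℕ-↑ʳ _ j)

    opOf-inl : ∀ a → opOf S P (inl a) ≡ opOf S P′ a
    opOf-inl (c , j) = lookup-++-↑ˡ (P′ c) (P″ c) j

    opOf-inr : ∀ b → opOf S P (inr b) ≡ opOf S P″ b
    opOf-inr (c , j) = lookup-++-↑ʳ (P′ c) (P″ c) j

    order-inl : ∀ a a′ → ProgramOrder P (inl a) (inl a′) ⇔ ProgramOrder P′ a a′
    order-inl (c , j) (c′ , j′) rewrite position-inl c j | position-inl c′ j′ = ⇔-id _

    order-inr : ∀ b b′ → ProgramOrder P (inr b) (inr b′) ⇔ ProgramOrder P″ b b′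
    order-inr (c , j) (c′ , j′) rewrite position-inr c j | position-inr c′ j′ =
      mk⇔ (λ { (refl , lt) → refl , ℕₚ.+-cancelˡ-< (length (P′ c)) _ _ lt })
          (λ { (refl , lt) → refl , ℕₚ.+-monoʳ-< (length (P′ c)) lt })

    order-inl-inr : ∀ a b → ProgramOrder P (inl a) (inr b) ⇔ (proj₁ a ≡ proj₁ b)
    order-inl-inr (c , j) (c′ , j′) rewrite position-inl c j | position-inr c′ j′ =
      mk⇔ proj₁ λ { refl → refl , ℕₚ.<-≤-trans (Finₚ.toℕ<n j) (ℕₚ.m≤m+n _ _) }

    ¬order-inr-inl : ∀ b a → ¬ ProgramOrder P (inr b) (inl a)
    ¬order-inr-inl (c , j) (c′ , j′) rewrite position-inr c j | position-inl c′ j′ = λ where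
      (refl , lt) → ℕₚ.<-asym lt (ℕₚ.<-≤-trans (Finₚ.toℕ<n j′) (ℕₚ.m≤m+n _ _))

    inlᵉ : Event S P′ → Event S P
    inlᵉ (a , st) = inl a , st

    inrᵉ : Event S P″ → Event S P
    inrᵉ (b , st) = inr b , st

    inlᵉ-injective : ∀ {e e′} → inlᵉ e ≡ inlᵉ e′ → e ≡ e′
    inlᵉ-injective {_ , _} {_ , _} eq = cong₂ _,_ (inl-injective (cong proj₁ eq)) (cong proj₂ eq)

    inrᵉ-injective : ∀ {e e′} → inrᵉ e ≡ inrᵉ e′ → e ≡ e′
    inrᵉ-injective {_ , _} {_ , _} eq = cong₂ _,_ (inr-injective (cong proj₁ eq)) (cong proj₂ eq)

    inlᵉ≢inrᵉ : ∀ {e f} → inlᵉ e ≢ inrᵉ f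
    inlᵉ≢inrᵉ {_ , _} {_ , _} eq = inl≢inr (cong proj₁ eq)

    data Locatedᵉ : Event S P → Set where
      prefix   : ∀ e → Locatedᵉ (inlᵉ e)
      residual : ∀ f → Locatedᵉ (inrᵉ f)

    locatedᵉ : ∀ e → Locatedᵉ e
    locatedᵉ (x , st) with located x
    ... | prefix a   = prefix (a , st)
    ... | residual b = residual (b , st)

    finiteEvent : (Q : Program S) → Finite (Event S Q)
    finiteEvent Q = ×-finite (Σ-finite λ c → Fin-finite (length (Q c))) (Fin-finite stages)

    module Join (G′ : Graph S P′) (G″ : Graph S P″) where

      _⟶_ : Event S P → Event S P → Set
      _⟶_ = ▷Edge S P′ P″ G′ G″

      _⟶′_ : Event S P′ → Event S P′ → Set
      _⟶′_ = Edge S P′ G′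

      _⟶″_ : Event S P″ → Event S P″ → Set
      _⟶″_ = Edge S P″ G″

      ⟶-inl : ∀ e f → inlᵉ e ⟶ inlᵉ f ⇔ e ⟶′ f
      ⟶-inl ((c , j) , _) ((c′ , j′) , _) rewrite split-embed c (inj₁ j) | split-embed c′ (inj₁ j′) = ⇔-id _

      ⟶-inr : ∀ e f → inrᵉ e ⟶ inrᵉ f ⇔ e ⟶″ f
      ⟶-inr ((c , j) , _) ((c′ , j′) , _) rewrite split-embed c (inj₂ j) | split-embed c′ (inj₂ j′) = ⇔-id _

      ⟶-inl-inr : ∀ e f → inlᵉ e ⟶ inrᵉ f ⇔ (Sink S P′ G′ e × Source S P″ G″ f)
      ⟶-inl-inr ((c , j) , _) ((c′ , j′) , _) rewrite split-embed c (inj₁ j) | split-embed c′ (inj₂ j′) = ⇔-id _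

      ¬⟶-inr-inl : ∀ f e → ¬ inrᵉ f ⟶ inlᵉ e
      ¬⟶-inr-inl ((c , j) , _) ((c′ , j′) , _) rewrite split-embed c (inj₂ j) | split-embed c′ (inj₁ j′) = λ ()

      _⟶⁺_ : Event S P → Event S P → Set
      _⟶⁺_ = TransClosure _⟶_

      -- No edge leaves the residual part, so a path starting there stays there.
      from-residual : ∀ {f e} → inrᵉ f ⟶⁺ e → ∃ λ f′ → e ≡ inrᵉ f′ × TransClosure _⟶″_ f f′
      from-residual {f} {e} [ f⟶e ] with locatedᵉ e
      ... | prefix e′   = ⊥-elim (¬⟶-inr-inl f e′ f⟶e)
      ... | residual f′ = f′ , refl , [ Equivalence.to (⟶-inr f f′) f⟶e ]
      from-residual {f} (_∷_ {y = m} f⟶m m⟶⁺e) with locatedᵉ m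
      ... | prefix e′   = ⊥-elim (¬⟶-inr-inl f e′ f⟶m)
      ... | residual f′ with from-residual m⟶⁺e
      ...   | f″ , refl , f′⟶⁺f″ = f″ , refl , Equivalence.to (⟶-inr f f′) f⟶m ∷ f′⟶⁺f″

      into-prefix : ∀ {d e} → d ⟶⁺ inlᵉ e → ∃ λ e′ → d ≡ inlᵉ e′ × TransClosure _⟶′_ e′ e
      into-prefix {d} {e} [ d⟶e ] with locatedᵉ d
      ... | prefix e′   = e′ , refl , [ Equivalence.to (⟶-inl e′ e) d⟶e ]
      ... | residual f  = ⊥-elim (¬⟶-inr-inl f e d⟶e)
      into-prefix {d} (_∷_ {y = m} d⟶m m⟶⁺e) with into-prefix m⟶⁺e
      ... | e′ , refl , e′⟶⁺e with locatedᵉ d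
      ...   | prefix d′  = d′ , refl , Equivalence.to (⟶-inl d′ e′) d⟶m ∷ e′⟶⁺e
      ...   | residual f = ⊥-elim (¬⟶-inr-inl f e′ d⟶m)

      ⁺-inl : ∀ e e′ → inlᵉ e ⟶⁺ inlᵉ e′ ⇔ TransClosure _⟶′_ e e′
      ⁺-inl e e′ = mk⇔ (λ p → let (d , eq , q) = into-prefix p in subst (λ d → TransClosure _⟶′_ d e′) (sym (inlᵉ-injective eq)) q)
                       (map⁺ inlᵉ (Equivalence.from (⟶-inl _ _)))

      ⁺-inr : ∀ f f′ → inrᵉ f ⟶⁺ inrᵉ f′ ⇔ TransClosure _⟶″_ f f′
      ⁺-inr f f′ = mk⇔ (λ p → let (d , eq , q) = from-residual p in subst (TransClosure _⟶″_ f) (sym (inrᵉ-injective eq)) q)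
                       (map⁺ inrᵉ (Equivalence.from (⟶-inr _ _)))

      ¬⁺-inr-inl : ∀ f e → ¬ inrᵉ f ⟶⁺ inlᵉ e
      ¬⁺-inr-inl f e p = let (_ , eq , _) = from-residual p in inlᵉ≢inrᵉ eq

      module _ (acyclic′ : Acyclic S P′ G′) (acyclic″ : Acyclic S P″ G″) where

        _⟶′?_ : ∀ e e′ → Dec (e ⟶′ e′)
        e ⟶′? e′ = G′ e e′ Boolₚ.≟ true

        _⟶″?_ : ∀ f f′ → Dec (f ⟶″ f′)
        f ⟶″? f′ = G″ f f′ Boolₚ.≟ true

        module Prefix = FiniteAcyclic (finiteEvent P′) _⟶′_ _⟶′?_ acyclic′
        module Residualᵒᵖ = FiniteAcyclic (finiteEvent P″) (flip _⟶″_) (flip _⟶″?_) (λ f → acyclic″ f ∘ reverse⁺)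

        -- Follow G′ to a sink and G″ backwards to a source; ▷ joins the two.
        inl⟶⁺inr : ∀ e f → inlᵉ e ⟶⁺ inrᵉ f
        inl⟶⁺inr e f with Prefix.reaches-sink e | Residualᵒᵖ.reaches-sink f
        ... | t , sink , e⟶*t | t′ , source , f⟶*t′ = into-source f⟶*t′ (from-sink e⟶*t)
          where
          bridge : inlᵉ t ⟶ inrᵉ t′
          bridge = Equivalence.from (⟶-inl-inr t t′) ((λ z → Boolₚ.¬-not (sink z)) , (λ z → Boolₚ.¬-not (source z)))
          from-sink : t ≡ e ⊎ TransClosure _⟶′_ e t → inlᵉ e ⟶⁺ inrᵉ t′
          from-sink (inj₁ refl) = [ bridge ]
          from-sink (inj₂ e⟶⁺t) = map⁺ inlᵉ (Equivalence.from (⟶-inl _ _)) e⟶⁺t ∷ʳ bridge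
          into-source : t′ ≡ f ⊎ TransClosure (flip _⟶″_) f t′ → inlᵉ e ⟶⁺ inrᵉ t′ → inlᵉ e ⟶⁺ inrᵉ f
          into-source (inj₁ refl) p = p
          into-source (inj₂ f⟵⁺t′) p = p ++⁺ map⁺ inrᵉ (Equivalence.from (⟶-inr _ _)) (reverse⁺ f⟵⁺t′)

        _⟶?_ : ∀ d e → Dec (d ⟶ e)
        d ⟶? e with locatedᵉ d | locatedᵉ e
        ... | prefix d′   | prefix e′   = Dec.map (⇔-sym (⟶-inl d′ e′)) (d′ ⟶′? e′)
        ... | residual d′ | residual e′ = Dec.map (⇔-sym (⟶-inr d′ e′)) (d′ ⟶″? e′)
        ... | residual d′ | prefix e′   = no (¬⟶-inr-inl d′ e′)
        ... | prefix d′   | residual e′ = Dec.map (⇔-sym (⟶-inl-inr d′ e′))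
          (Finite.all? (finiteEvent P′) (λ z → G′ d′ z Boolₚ.≟ false) ×-dec Finite.all? (finiteEvent P″) (λ z → G″ z e′ Boolₚ.≟ false))

        acyclic : ∀ e → ¬ e ⟶⁺ e
        acyclic e with locatedᵉ e
        ... | prefix e′   = acyclic′ e′ ∘ Equivalence.to (⁺-inl e′ e′)
        ... | residual e′ = acyclic″ e′ ∘ Equivalence.to (⁺-inr e′ e′)

        module Joined = FiniteAcyclic (finiteEvent P) _⟶_ _⟶?_ acyclic

  ⟦⟧-cong : ∀ {k} {P : Program S} {E} {s : Fin k → Instr S P} {B : Atoms k} →
            atomsOf P E s ≈ᵃ B → ∀ φ → ⟦_⟧ S φ P E s ⇔ Holds B φ
  ⟦⟧-cong {P = P} {E} {s} A≈B φ = Holds-cong A≈B φ ⇔-∘ ⟦⟧⇔Holds P E s φ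

  -- Part (true = residual), core, operation, rank among same-core variables and hb, per variable;
  -- vectors rather than functions so that shapes can be searched exhaustively.
  record Shape (k : ℕ) : Set where
    constructor shape
    field
      partᵛ  : Vec Bool k
      coreᵛ  : Vec (Fin cores) k
      opᵛ    : Vec (Fin ops) k
      labelᵛ : Vec (Fin k) k
      hbᵛ    : Vec (Vec (Vec (Vec Bool stages) k) stages) k

    inResidual : Fin k → Bool
    inResidual = Vec.lookup partᵛ

    core : Fin k → Fin cores
    core = Vec.lookup coreᵛ

    op : Fin k → Fin ops
    op = Vec.lookup opᵛ

    label : Fin k → Fin k
    label = Vec.lookup labelᵛ

    hbᵇ : Fin k → Fin stages → Fin k → Fin stages → Bool
    hbᵇ u s v t = Vec.lookup (Vec.lookup (Vec.lookup (Vec.lookup hbᵛ u) s) v) t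

  Shape-searchable : ∀ k → Searchable (Shape k)
  Shape-searchable k P? = map′ (λ p d → p (Shape.partᵛ d , Shape.coreᵛ d , Shape.opᵛ d , Shape.labelᵛ d , Shape.hbᵛ d))
                               (λ p (vs , cs , os , ls , hs) → p (shape vs cs os ls hs))
    (×-searchable bools (×-searchable (fins cores) (×-searchable (fins ops) (×-searchable (fins k)
      (Vec-searchable k (Vec-searchable stages (Vec-searchable k (Vec-searchable stages Bool-searchable)))))))
      λ (vs , cs , os , ls , hs) → P? (shape vs cs os ls hs))
    where
    bools = Vec-searchable k Bool-searchable
    fins : ∀ n → Searchable (Vec (Fin n) k)
    fins n = Vec-searchable k (Finₚ.all?)

  record Valid {k} (d : Shape k) : Set where
    open Shape d
    field
      prefix-inhabited   : ∃ λ v → inResidual v ≡ false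
      residual-inhabited : ∃ λ v → inResidual v ≡ true
      label-separates    : ∀ u v → core u ≡ core v → label u ≡ label v → u ≡ v
      prefix-first       : ∀ u v → core u ≡ core v → inResidual u ≡ false → inResidual v ≡ true → label u Fin.< label v
      hb-irreflexive     : ∀ u s → hbᵇ u s u s ≡ false
      hb-transitive      : ∀ u s v t w r → hbᵇ u s v t ≡ true → hbᵇ v t w r ≡ true → hbᵇ u s w r ≡ true
      prefix-hb-residual : ∀ u s v t → inResidual u ≡ false → inResidual v ≡ true → hbᵇ u s v t ≡ true

    residual-¬hb-prefix : ∀ u s v t → inResidual u ≡ true → inResidual v ≡ false → ¬ hbᵇ u s v t ≡ true
    residual-¬hb-prefix u s v t res pre u⟶v with trans (sym (hb-irreflexive u s)) (hb-transitive u s v t u s u⟶v (prefix-hb-residual v t u s pre res))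
    ... | ()

  Valid? : ∀ {k} (d : Shape k) → Dec (Valid d)
  Valid? d = map′ (λ (a , b , c , e , f , g , h) → record
                     { prefix-inhabited = a ; residual-inhabited = b ; label-separates = c ; prefix-first = e
                     ; hb-irreflexive = f ; hb-transitive = g ; prefix-hb-residual = h })
                  (λ r → let open Valid r in prefix-inhabited , residual-inhabited , label-separates , prefix-first
                                           , hb-irreflexive , hb-transitive , prefix-hb-residual)
    ( Finₚ.any? (λ v → inResidual v Boolₚ.≟ false)
    ×-dec Finₚ.any? (λ v → inResidual v Boolₚ.≟ true)
    ×-dec Finₚ.all? (λ u → Finₚ.all? λ v → (core u Finₚ.≟ core v) →-dec (label u Finₚ.≟ label v) →-dec (u Finₚ.≟ v))
    ×-dec Finₚ.all? (λ u → Finₚ.all? λ v → (core u Finₚ.≟ core v) →-dec (inResidual u Boolₚ.≟ false) →-dec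
                                            (inResidual v Boolₚ.≟ true) →-dec (label u Finₚ.<? label v))
    ×-dec Finₚ.all? (λ u → Finₚ.all? λ s → hbᵇ u s u s Boolₚ.≟ false)
    ×-dec Finₚ.all? (λ u → Finₚ.all? λ s → Finₚ.all? λ v → Finₚ.all? λ t → Finₚ.all? λ w → Finₚ.all? λ r →
                       (hbᵇ u s v t Boolₚ.≟ true) →-dec (hbᵇ v t w r Boolₚ.≟ true) →-dec (hbᵇ u s w r Boolₚ.≟ true))
    ×-dec Finₚ.all? (λ u → Finₚ.all? λ s → Finₚ.all? λ v → Finₚ.all? λ t →
                       (inResidual u Boolₚ.≟ false) →-dec (inResidual v Boolₚ.≟ true) →-dec (hbᵇ u s v t Boolₚ.≟ true)))
    where open Shape d

  shapeAtoms : ∀ {k} → Shape k → Atoms k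
  shapeAtoms d = record
    { poᵃ   = λ u v → core u ≡ core v × label u Fin.< label v
    ; hbᵃ   = λ u s v t → hbᵇ u s v t ≡ true
    ; predᵃ = λ p xs → interp p (Vec.map op xs) ≡ true
    }
    where open Shape d

  shapeAtoms? : ∀ {k} (d : Shape k) → DecidableAtoms (shapeAtoms d)
  shapeAtoms? d = record
    { poᵃ?   = λ u v → (core u Finₚ.≟ core v) ×-dec (label u Finₚ.<? label v)
    ; hbᵃ?   = λ u s v t → hbᵇ u s v t Boolₚ.≟ true
    ; predᵃ? = λ p xs → interp p (Vec.map op xs) Boolₚ.≟ true
    }
    where open Shape d

  HoldsOnShapes : Axiom S → Set
  HoldsOnShapes ax = ∀ (d : Shape (Axiom.k ax)) → Valid d → Holds (shapeAtoms d) (Axiom.φ ax)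

  HoldsOnShapes? : ∀ ax → Dec (HoldsOnShapes ax)
  HoldsOnShapes? ax = Shape-searchable (Axiom.k ax) λ d → Valid? d →-dec Holds? (shapeAtoms? d) (Axiom.φ ax)

  module Soundness (ax : Axiom S) (check : HoldsOnShapes ax) (P′ P″ : Program S) (G′ : Graph S P′) (G″ : Graph S P″)
                   (acyclic′ : Acyclic S P′ G′) (acyclic″ : Acyclic S P″ G″) where
    open Axiom ax
    open Concat P′ P″
    open Join G′ G″

    prefix-part : ∀ x → isResidual x ≡ false → ∃ λ a → x ≡ inl a
    prefix-part x pre with located x
    ... | prefix a   = a , refl
    ... | residual b with trans (sym (isResidual-inr b)) pre
    ...   | ()

    residual-part : ∀ x → isResidual x ≡ true → ∃ λ b → x ≡ inr b
    residual-part x res with located x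
    ... | residual b = b , refl
    ... | prefix a with trans (sym (isResidual-inl a)) res
    ...   | ()

    prefix-before-residual : ∀ {x y} → isResidual x ≡ false → isResidual y ≡ true → proj₁ x ≡ proj₁ y → ProgramOrder P x y
    prefix-before-residual {x} {y} pre res same with prefix-part x pre | residual-part y res
    ... | a , refl | b , refl = Equivalence.from (order-inl-inr a b) same

    prefix-hb-residual : ∀ {x y} st st′ → isResidual x ≡ false → isResidual y ≡ true → (x , st) ⟶⁺ (y , st′)
    prefix-hb-residual {x} {y} st st′ pre res with prefix-part x pre | residual-part y res
    ... | a , refl | b , refl = inl⟶⁺inr acyclic′ acyclic″ (a , st) (b , st′)

    module _ (s : Fin k → Instr S P) (s-injective : Injective _≡_ _≡_ s) where

      prefix-atoms : (s′ : Fin k → Instr S P′) → (∀ v → s v ≡ inl (s′ v)) → atomsOf P _⟶_ s ≈ᵃ atomsOf P′ _⟶′_ s′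
      prefix-atoms s′ s≡ = record
        { poᵃ-⇔   = λ a b → subst₂ (λ x y → ProgramOrder P x y ⇔ _) (sym (s≡ a)) (sym (s≡ b)) (order-inl (s′ a) (s′ b))
        ; hbᵃ-⇔   = λ a st b st′ → subst₂ (λ x y → (x , st) ⟶⁺ (y , st′) ⇔ _) (sym (s≡ a)) (sym (s≡ b)) (⁺-inl (s′ a , st) (s′ b , st′))
        ; predᵃ-⇔ = interp-cong (opOf S P ∘ s) (opOf S P′ ∘ s′) λ v → trans (cong (opOf S P) (s≡ v)) (opOf-inl (s′ v))
        }

      residual-atoms : (s″ : Fin k → Instr S P″) → (∀ v → s v ≡ inr (s″ v)) → atomsOf P _⟶_ s ≈ᵃ atomsOf P″ _⟶″_ s″
      residual-atoms s″ s≡ = record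
        { poᵃ-⇔   = λ a b → subst₂ (λ x y → ProgramOrder P x y ⇔ _) (sym (s≡ a)) (sym (s≡ b)) (order-inr (s″ a) (s″ b))
        ; hbᵃ-⇔   = λ a st b st′ → subst₂ (λ x y → (x , st) ⟶⁺ (y , st′) ⇔ _) (sym (s≡ a)) (sym (s≡ b)) (⁺-inr (s″ a , st) (s″ b , st′))
        ; predᵃ-⇔ = interp-cong (opOf S P ∘ s) (opOf S P″ ∘ s″) λ v → trans (cong (opOf S P) (s≡ v)) (opOf-inr (s″ v))
        }

      within-prefix : (∀ v → isResidual (s v) ≡ false) → Sat S P′ G′ ax → ⟦_⟧ S φ P _⟶_ s
      within-prefix pre sat′ = Equivalence.from (⟦⟧-cong (prefix-atoms s′ s≡) φ)
                                 (Equivalence.to (⟦⟧⇔Holds P′ _⟶′_ s′ φ) (sat′ s′ s′-injective))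
        where
        s′ = λ v → proj₁ (prefix-part (s v) (pre v))
        s≡ = λ v → proj₂ (prefix-part (s v) (pre v))
        s′-injective : Injective _≡_ _≡_ s′
        s′-injective {u} {v} eq = s-injective (trans (s≡ u) (trans (cong inl eq) (sym (s≡ v))))

      within-residual : (∀ v → isResidual (s v) ≡ true) → Sat S P″ G″ ax → ⟦_⟧ S φ P _⟶_ s
      within-residual res sat″ = Equivalence.from (⟦⟧-cong (residual-atoms s″ s≡) φ)
                                   (Equivalence.to (⟦⟧⇔Holds P″ _⟶″_ s″ φ) (sat″ s″ s″-injective))
        where
        s″ = λ v → proj₁ (residual-part (s v) (res v))
        s≡ = λ v → proj₂ (residual-part (s v) (res v))
        s″-injective : Injective _≡_ _≡_ s″
        s″-injective {u} {v} eq = s-injective (trans (s≡ u) (trans (cong inr eq) (sym (s≡ v))))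

      module Closure = Joined acyclic′ acyclic″

      separates : ∀ {u v} → proj₁ (s u) ≡ proj₁ (s v) → toℕ (proj₂ (s u)) ≡ toℕ (proj₂ (s v)) → u ≡ v
      separates same-core same-position = s-injective (Σ-Fin-≡ same-core same-position)

      open Rank Finₚ._≟_ (proj₁ ∘ s) (toℕ ∘ proj₂ ∘ s) separates

      hbᵈ : Fin k → Fin stages → Fin k → Fin stages → Bool
      hbᵈ u st v st′ = does ((s u , st) Closure.⟶⁺? (s v , st′))

      abstraction : Shape k
      abstraction = shape (tabulate (isResidual ∘ s)) (tabulate (proj₁ ∘ s)) (tabulate (opOf S P ∘ s)) (tabulate rank)
                          (tabulate λ u → tabulate λ st → tabulate λ v → tabulate λ st′ → hbᵈ u st v st′)

      open Shape abstraction

      inResidual-abs : ∀ v → inResidual v ≡ isResidual (s v)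
      inResidual-abs = Vecₚ.lookup∘tabulate (isResidual ∘ s)

      core-abs : ∀ v → core v ≡ proj₁ (s v)
      core-abs = Vecₚ.lookup∘tabulate (proj₁ ∘ s)

      op-abs : ∀ v → op v ≡ opOf S P (s v)
      op-abs = Vecₚ.lookup∘tabulate (opOf S P ∘ s)

      label-abs : ∀ v → label v ≡ rank v
      label-abs = Vecₚ.lookup∘tabulate rank

      hbᵇ⇔⟶⁺ : ∀ u st v st′ → hbᵇ u st v st′ ≡ true ⇔ (s u , st) ⟶⁺ (s v , st′)
      hbᵇ⇔⟶⁺ u st v st′ rewrite Vecₚ.lookup∘tabulate (λ u → tabulate λ st → tabulate λ v → tabulate λ st′ → hbᵈ u st v st′) u
                                 | Vecₚ.lookup∘tabulate (λ st → tabulate λ v → tabulate λ st′ → hbᵈ u st v st′) st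
                                 | Vecₚ.lookup∘tabulate (λ v → tabulate λ st′ → hbᵈ u st v st′) v
                                 | Vecₚ.lookup∘tabulate (λ st′ → hbᵈ u st v st′) st′
                                 = does≡true⇔ ((s u , st) Closure.⟶⁺? (s v , st′))

      same-core : ∀ {u v} → core u ≡ core v → proj₁ (s u) ≡ proj₁ (s v)
      same-core {u} {v} eq = trans (sym (core-abs u)) (trans eq (core-abs v))

      label-<⇔ : ∀ {u v} → label u Fin.< label v ⇔ rank u Fin.< rank v
      label-<⇔ {u} {v} rewrite label-abs u | label-abs v = ⇔-id _

      abstraction-valid : (∃ λ v → isResidual (s v) ≡ false) → (∃ λ v → isResidual (s v) ≡ true) → Valid abstraction
      abstraction-valid (u , pre) (v , res) = record
        { prefix-inhabited   = u , trans (inResidual-abs u) pre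
        ; residual-inhabited = v , trans (inResidual-abs v) res
        ; label-separates    = λ u v same eq → rank-injective (same-core same) (trans (sym (label-abs u)) (trans eq (label-abs v)))
        ; prefix-first       = λ u v same pre res → Equivalence.from label-<⇔ (rank-mono (same-core same)
                                 (proj₂ (prefix-before-residual (trans (sym (inResidual-abs u)) pre) (trans (sym (inResidual-abs v)) res) (same-core same))))
        ; hb-irreflexive     = λ u st → Boolₚ.¬-not (acyclic acyclic′ acyclic″ _ ∘ Equivalence.to (hbᵇ⇔⟶⁺ u st u st))
        ; hb-transitive      = λ u st v st′ w st″ uv vw → Equivalence.from (hbᵇ⇔⟶⁺ u st w st″)
                                 (Equivalence.to (hbᵇ⇔⟶⁺ u st v st′) uv ++⁺ Equivalence.to (hbᵇ⇔⟶⁺ v st′ w st″) vw)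
        ; prefix-hb-residual = λ u st v st′ pre res → Equivalence.from (hbᵇ⇔⟶⁺ u st v st′)
                                 (prefix-hb-residual st st′ (trans (sym (inResidual-abs u)) pre) (trans (sym (inResidual-abs v)) res))
        }

      abstraction-atoms : atomsOf P _⟶_ s ≈ᵃ shapeAtoms abstraction
      abstraction-atoms = record
        { poᵃ-⇔   = λ u v → mk⇔ (λ (same , lt) → trans (core-abs u) (trans same (sym (core-abs v))) , Equivalence.from label-<⇔ (rank-mono same lt))
                                (λ (same , lt) → same-core same , rank-reflects-< (same-core same) (Equivalence.to label-<⇔ lt))
        ; hbᵃ-⇔   = λ u st v st′ → ⇔-sym (hbᵇ⇔⟶⁺ u st v st′)
        ; predᵃ-⇔ = interp-cong (opOf S P ∘ s) op (sym ∘ op-abs)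
        }

      holds : Sat S P′ G′ ax → Sat S P″ G″ ax → ⟦_⟧ S φ P _⟶_ s
      holds sat′ sat″ with Finₚ.any? (λ v → isResidual (s v) Boolₚ.≟ false) | Finₚ.any? (λ v → isResidual (s v) Boolₚ.≟ true)
      ... | yes pre | yes res = Equivalence.from (⟦⟧-cong abstraction-atoms φ) (check abstraction (abstraction-valid pre res))
      ... | no ¬pre | _       = within-residual (λ v → Boolₚ.¬-not (¬pre ∘ (v ,_))) sat″
      ... | yes _   | no ¬res = within-prefix (λ v → Boolₚ.¬-not (¬res ∘ (v ,_))) sat′

  HoldsOnShapes⇒Extensible : ∀ ax → HoldsOnShapes ax → Extensible S ax
  HoldsOnShapes⇒Extensible ax check P′ P″ G′ G″ acyclic′ acyclic″ sat′ sat″ s s-injective =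
    Soundness.holds ax check P′ P″ G′ G″ acyclic′ acyclic″ s s-injective sat′ sat″

  module Realisation (ax : Axiom S) (d : Shape (Axiom.k ax)) (valid : Valid d) where
    open Axiom ax
    open Shape d
    open Valid valid

    Occupant : Bool → Fin cores → Fin k → Fin k → Set
    Occupant σ c l v = inResidual v ≡ σ × core v ≡ c × label v ≡ l

    occupant? : ∀ σ c l → Dec (∃ (Occupant σ c l))
    occupant? σ c l = Finₚ.any? λ v → (inResidual v Boolₚ.≟ σ) ×-dec (core v Finₚ.≟ c) ×-dec (label v Finₚ.≟ l)

    occupied : Bool → Fin cores → Fin k → Bool
    occupied σ c l = does (occupant? σ c l)

    -- The fallback l is junk: variableAt is only consulted at occupied slots.
    variableAt : Bool → Fin cores → Fin k → Fin k
    variableAt σ c l with occupant? σ c l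
    ... | yes (v , _) = v
    ... | no _        = l

    variableAt-occupies : ∀ σ c l → occupied σ c l ≡ true → Occupant σ c l (variableAt σ c l)
    variableAt-occupies σ c l occ with occupant? σ c l
    ... | yes (v , occupies) = occupies
    variableAt-occupies σ c l () | no _

    -- Part σ lists, core by core and in order of label, the operations of the variables in that part.
    program : Bool → Program S
    program σ c = select (occupied σ c) (op ∘ variableAt σ c)

    slot : ∀ σ → Instr S (program σ) → Fin k
    slot σ (c , j) = origin (occupied σ c) (op ∘ variableAt σ c) j

    variableOf : ∀ σ → Instr S (program σ) → Fin k
    variableOf σ (c , j) = variableAt σ c (slot σ (c , j))

    variableOf-occupies : ∀ σ x → Occupant σ (proj₁ x) (slot σ x) (variableOf σ x)
    variableOf-occupies σ (c , j) = variableAt-occupies σ c _ (origin-kept (occupied σ c) _ j)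

    variableOf-injective : ∀ σ → Injective _≡_ _≡_ (variableOf σ)
    variableOf-injective σ {c , j} {c′ , j′} eq
      with c≡c′ ← trans (sym (proj₁ (proj₂ (variableOf-occupies σ (c , j))))) (trans (cong core eq) (proj₁ (proj₂ (variableOf-occupies σ (c′ , j′)))))
      with refl ← c≡c′
      = cong (c ,_) (strictMono⇒injective (origin-mono (occupied σ c) _)
          (trans (sym (proj₂ (proj₂ (variableOf-occupies σ (c , j))))) (trans (cong label eq) (proj₂ (proj₂ (variableOf-occupies σ (c , j′)))))))

    own-slot-occupied : ∀ σ v → inResidual v ≡ σ → occupied σ (core v) (label v) ≡ true
    own-slot-occupied σ v part = Equivalence.from (does≡true⇔ (occupant? σ (core v) (label v))) (v , part , refl , refl)

    instruction : ∀ σ v → inResidual v ≡ σ → Instr S (program σ)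
    instruction σ v part = core v , position (occupied σ (core v)) _ (label v) (own-slot-occupied σ v part)

    variableOf-instruction : ∀ σ v part → variableOf σ (instruction σ v part) ≡ v
    variableOf-instruction σ v part = label-separates _ v same-core same-label
      where
      slot≡label : slot σ (instruction σ v part) ≡ label v
      slot≡label = origin-position (occupied σ (core v)) _ (label v) (own-slot-occupied σ v part)
      occupies = variableOf-occupies σ (instruction σ v part)
      same-core = proj₁ (proj₂ occupies)
      same-label = trans (proj₂ (proj₂ occupies)) slot≡label

    opOf-instruction : ∀ σ v part → opOf S (program σ) (instruction σ v part) ≡ op v
    opOf-instruction σ v part = trans (lookup-select (occupied σ (core v)) _ _) (cong op (variableOf-instruction σ v part))

    order-instruction : ∀ σ u v pu pv → ProgramOrder (program σ) (instruction σ u pu) (instruction σ v pv) ⇔ (core u ≡ core v × label u Fin.< label v)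
    order-instruction σ u v pu pv = in-slots (core u) (core v) (own-slot-occupied σ u pu) (own-slot-occupied σ v pv)
      where
      in-slots : ∀ c c′ (ou : occupied σ c (label u) ≡ true) (ov : occupied σ c′ (label v) ≡ true) →
                 ProgramOrder (program σ) (c , position (occupied σ c) _ (label u) ou) (c′ , position (occupied σ c′) _ (label v) ov)
                 ⇔ (c ≡ c′ × label u Fin.< label v)
      in-slots c c′ ou ov = mk⇔ (λ { (refl , lt) → refl , Equivalence.to (position-<⇔ (occupied σ c) _ ou ov) lt })
                                (λ { (refl , lt) → refl , Equivalence.from (position-<⇔ (occupied σ c) _ ou ov) lt })

    graph : ∀ σ → Graph S (program σ)
    graph σ (x , st) (y , st′) = hbᵇ (variableOf σ x) st (variableOf σ y) st′

    graph-closed : ∀ σ {e f} → TransClosure (Edge S (program σ) (graph σ)) e f → graph σ e f ≡ true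
    graph-closed σ [ e⟶f ] = e⟶f
    graph-closed σ {x , st} {z , st″} (_∷_ {y = y , st′} e⟶m m⟶⁺f) =
      hb-transitive (variableOf σ x) st (variableOf σ y) st′ (variableOf σ z) st″ e⟶m (graph-closed σ m⟶⁺f)

    graph-acyclic : ∀ σ → Acyclic S (program σ) (graph σ)
    graph-acyclic σ (x , st) cycle with trans (sym (graph-closed σ cycle)) (hb-irreflexive (variableOf σ x) st)
    ... | ()

    -- Part σ has fewer than k instructions, so no injective assignment of k variables exists.
    graph-sat : ∀ σ → (∃ λ w → inResidual w ≡ not σ) → Sat S (program σ) (graph σ) ax
    graph-sat σ (w , w-elsewhere) t t-injective = ⊥-elim
      (injective⇒hits (variableOf σ ∘ t) (t-injective ∘ variableOf-injective σ) w λ i eq → Boolₚ.not-¬ refl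
        (trans (sym (proj₁ (variableOf-occupies σ (t i)))) (trans (cong inResidual eq) w-elsewhere)))

    open Concat (program false) (program true)
    open Join (graph false) (graph true)

    realise-in : ∀ v σ → inResidual v ≡ σ → Instr S P
    realise-in v false pre = inl (instruction false v pre)
    realise-in v true  res = inr (instruction true v res)

    realise : Fin k → Instr S P
    realise v = realise-in v (inResidual v) refl

    data Realised (v : Fin k) : Instr S P → Set where
      prefix   : (pre : inResidual v ≡ false) → Realised v (inl (instruction false v pre))
      residual : (res : inResidual v ≡ true) → Realised v (inr (instruction true v res))

    realised : ∀ v → Realised v (realise v)
    realised v = realised-in (inResidual v) refl
      where
      realised-in : ∀ σ (part : inResidual v ≡ σ) → Realised v (realise-in v σ part)
      realised-in false pre = prefix pre
      realised-in true  res = residual res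

    realise-injective : Injective _≡_ _≡_ realise
    realise-injective {u} {v} eq with realise u | realised u | realise v | realised v
    ... | _ | prefix pu   | _ | prefix pv   = trans (sym (variableOf-instruction false u pu))
                                                (trans (cong (variableOf false) (inl-injective eq)) (variableOf-instruction false v pv))
    ... | _ | residual ru | _ | residual rv = trans (sym (variableOf-instruction true u ru))
                                                (trans (cong (variableOf true) (inr-injective eq)) (variableOf-instruction true v rv))
    ... | _ | prefix _    | _ | residual _  = ⊥-elim (inl≢inr eq)
    ... | _ | residual _  | _ | prefix _    = ⊥-elim (inl≢inr (sym eq))

    realise-order : ∀ u v → ProgramOrder P (realise u) (realise v) ⇔ (core u ≡ core v × label u Fin.< label v)
    realise-order u v with realise u | realised u | realise v | realised v
    ... | _ | prefix pu   | _ | prefix pv   = order-instruction false u v pu pv ⇔-∘ order-inl _ _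
    ... | _ | residual ru | _ | residual rv = order-instruction true u v ru rv ⇔-∘ order-inr _ _
    ... | _ | prefix pu   | _ | residual rv =
      mk⇔ (λ same → same , prefix-first u v same pu rv) proj₁ ⇔-∘ order-inl-inr _ _
    ... | _ | residual ru | _ | prefix pv   =
      mk⇔ (⊥-elim ∘ ¬order-inr-inl _ _) λ (same , u<v) → ⊥-elim (Finₚ.<-asym u<v (prefix-first v u (sym same) pv ru))

    hb-instruction : ∀ σ u v pu pv st st′ → TransClosure (Edge S (program σ) (graph σ)) (instruction σ u pu , st) (instruction σ v pv , st′)
                                         ⇔ hbᵇ u st v st′ ≡ true
    hb-instruction σ u v pu pv st st′ =
      subst₂ (λ u′ v′ → TransClosure (Edge S (program σ) (graph σ)) (instruction σ u pu , st) (instruction σ v pv , st′) ⇔ hbᵇ u′ st v′ st′ ≡ true) (variableOf-instruction σ u pu) (variableOf-instruction σ v pv)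
             (mk⇔ (graph-closed σ) [_])

    realise-hb : ∀ u st v st′ → (realise u , st) ⟶⁺ (realise v , st′) ⇔ hbᵇ u st v st′ ≡ true
    realise-hb u st v st′ with realise u | realised u | realise v | realised v
    ... | _ | prefix pu   | _ | prefix pv   = hb-instruction false u v pu pv st st′ ⇔-∘ ⁺-inl _ _
    ... | _ | residual ru | _ | residual rv = hb-instruction true u v ru rv st st′ ⇔-∘ ⁺-inr _ _
    ... | _ | prefix pu   | _ | residual rv =
      mk⇔ (λ _ → prefix-hb-residual u st v st′ pu rv) (λ _ → inl⟶⁺inr (graph-acyclic false) (graph-acyclic true) _ _)
    ... | _ | residual ru | _ | prefix pv   =
      mk⇔ (⊥-elim ∘ ¬⁺-inr-inl _ _) (⊥-elim ∘ residual-¬hb-prefix u st v st′ ru pv)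

    realise-op : ∀ v → opOf S P (realise v) ≡ op v
    realise-op v with realise v | realised v
    ... | _ | prefix pv   = trans (opOf-inl _) (opOf-instruction false v pv)
    ... | _ | residual rv = trans (opOf-inr _) (opOf-instruction true v rv)

    realise-atoms : atomsOf P _⟶_ realise ≈ᵃ shapeAtoms d
    realise-atoms = record
      { poᵃ-⇔   = realise-order
      ; hbᵃ-⇔   = realise-hb
      ; predᵃ-⇔ = interp-cong (opOf S P ∘ realise) op realise-op
      }

  Extensible⇒HoldsOnShapes : ∀ ax → Extensible S ax → HoldsOnShapes ax
  Extensible⇒HoldsOnShapes ax extensible d valid = Equivalence.to (⟦⟧-cong realise-atoms (Axiom.φ ax))
    (extensible (program false) (program true) (graph false) (graph true) (graph-acyclic false) (graph-acyclic true)
                (graph-sat false residual-inhabited) (graph-sat true prefix-inhabited) realise realise-injective)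
    where
    open Realisation ax d valid
    open Valid valid

lemma2 : (S : Signature) (ax : Axiom S) → Dec (Extensible S ax)
lemma2 S ax = Dec.map (mk⇔ (HoldsOnShapes⇒Extensible S ax) (Extensible⇒HoldsOnShapes S ax)) (HoldsOnShapes? S ax)
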